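{- For every $\epsilon>0$ there exists $n_0$ such that for all $n\geq n_0$, $d_n \geq (1-\epsilon)\, n\, 2^{2^{n-1}}$.
   Context: A delta-matroid $(E,\mathcal F)$ consists of a finite set $E$ and a non-empty collection $\mathcal F$ of subsets of $E$ (the feasible sets) satisfying the symmetric exchange axiom: for all $X,Y\in\mathcal F$ and every $e\in X\bigtriangleup Y$ there exists $f\in X\bigtriangleup Y$ (possibly $f=e$) with $X\bigtriangleup\{e,f\}\in\mathcal F$. Let $d_n$ denote the number of delta-matroids with ground set $[n]=\{1,\dots,n\}$.
   Formalization: The parameter ε ranges over the positive rationals. -}

module Defs where

open import Data.Bool using (Bool; true; false; _xor_)
open import Data.Bool.Properties using () renaming (_≟_ to _≟ᵇ_)
open import Data.Nat using (ℕ; zero; suc)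
open import Data.Fin using (Fin)
open import Data.Fin.Subset using (Subset; _∈_; ⁅_⁆; _∪_)
open import Data.Fin.Subset.Properties using (_∈?_)
open import Data.List using (List; []; _∷_; _++_; map; length; filter; allFin)
open import Data.List.Relation.Unary.All using (All; all?)
open import Data.List.Relation.Unary.Any using (Any; any?)
open import Data.Vec using (Vec; []; _∷_; zipWith)
open import Data.Vec.Properties using (≡-dec)
open import Data.Product using (_×_)
open import Relation.Binary.PropositionalEquality using (_≡_; _≢_)
open import Relation.Nullary using (Dec; yes; no; ¬_)
open import Relation.Nullary.Decidable using (_×-dec_; _→-dec_; ¬?)

_△_ : ∀ {n} → Subset n → Subset n → Subset n
X △ Y = zipWith _xor_ X Y

allSubsets : (n : ℕ) → List (Subset n)
allSubsets zero = [] ∷ []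
allSubsets (suc n) = map (false ∷_) (allSubsets n) ++ map (true ∷_) (allSubsets n)

sublists : ∀ {a} {A : Set a} → List A → List (List A)
sublists [] = [] ∷ []
sublists (x ∷ xs) = sublists xs ++ map (x ∷_) (sublists xs)

-- A family of subsets of [n] is a (duplicate-free) list of subsets;
-- membership of a subset in the family:
_∈F_ : ∀ {n} → Subset n → List (Subset n) → Set
X ∈F F = Any (X ≡_) F

_∈F?_ : ∀ {n} (X : Subset n) (F : List (Subset n)) → Dec (X ∈F F)
X ∈F? F = any? (λ Y → ≡-dec _≟ᵇ_ X Y) F

SymmetricExchange : ∀ {n} → List (Subset n) → Set
SymmetricExchange {n} F =
  All (λ X → All (λ Y → All (λ e → e ∈ (X △ Y) →
      Any (λ f → (f ∈ (X △ Y)) × ((X △ (⁅ e ⁆ ∪ ⁅ f ⁆)) ∈F F)) (allFin n))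
    (allFin n)) F) F

IsDeltaMatroid : ∀ {n} → List (Subset n) → Set
IsDeltaMatroid F = (F ≢ []) × SymmetricExchange F

nonEmpty? : ∀ {a} {A : Set a} (xs : List A) → Dec (xs ≢ [])
nonEmpty? [] = no (λ p → p _≡_.refl)
nonEmpty? (x ∷ xs) = yes (λ ())

isDeltaMatroid? : ∀ {n} (F : List (Subset n)) → Dec (IsDeltaMatroid F)
isDeltaMatroid? {n} F = nonEmpty? F ×-dec
  all? (λ X → all? (λ Y → all? (λ e → (e ∈? (X △ Y)) →-dec
     any? (λ f → (f ∈? (X △ Y)) ×-dec ((X △ (⁅ e ⁆ ∪ ⁅ f ⁆)) ∈F? F)) (allFin n))
    (allFin n)) F) F

-- d n = number of delta-matroids on ground set [n]: families of subsets of
-- [n] (each enumerated exactly once as a sublist of allSubsets n) satisfying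
-- the axioms.
d : ℕ → ℕ
d n = length (filter isDeltaMatroid? (sublists (allSubsets n)))

-- For n ≥ 2 there are at least n · 2 ^ 2 ^ (n - 1) delta-matroids on [n], so one may take
-- n₀ = 2 for every ε > 0. Fix Z, an element a, and any selection among the sets that have the
-- other parity than Z and are not neighbours Z △ {e} of Z. The family of all sets of Z's
-- parity except Z, all neighbours of Z except Z △ {a}, and the selected sets is a
-- delta-matroid: from a set X of Z's parity, steps X △ {e, f} keep the parity and there is
-- room to dodge the single hole Z; from X of the other parity the step X △ {e} either avoids
-- Z, or X is a neighbour of Z and a step X △ {e, g} reaches another neighbour Z △ {g} with
-- g ≠ a. By the same kind of argument every family containing all even sets is a
-- delta-matroid. There are 2 ^ (n - 1) centres Z of each parity, n choices of a and
-- 2 ^ (2 ^ (n - 1) - n) selections; the two parities share only families with the full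
-- selection, and the 2 ^ 2 ^ (n - 1) families containing all even sets more than make up
-- for them.

module Submission where

open import Algebra.Bundles using (CommutativeRing)
open import Algebra.Definitions using (Associative)
open import Data.Bool using (Bool; true; false; not; _xor_; _∧_; T; if_then_else_)
open import Data.Bool.Properties
  using (xor-same; xor-comm; xor-assoc; xor-identityˡ; xor-identityʳ; xor-∧-commutativeRing; not-involutive; ¬-not; not-¬; T-≡; T-∧)
  renaming (_≟_ to _≟ᵇ_)
open import Data.Empty using (⊥-elim)
open import Data.Fin using (Fin; zero; suc; punchIn)
open import Data.Fin.Properties using (any?; _≟_; punchInᵢ≢i)
open import Data.Fin.Subset using (Subset; ⁅_⁆; _∪_) renaming (_∈_ to _∈ₛ_; ⊥ to ∅)
open import Data.Fin.Subset.Properties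
  using (_∈?_; x∈⁅x⁆; x∈⁅y⁆⇒x≡y; x∈p∪q⁺; x∈p∪q⁻; ⊆-antisym; ∪-idem; ∪-identityˡ; ∪-identityʳ)
import Data.Integer as ℤ
import Data.Integer.Properties as ℤ
open import Data.List using (List; []; _∷_; _++_; map; length; concatMap; filter; filterᵇ; allFin)
open import Data.List.Membership.Propositional using (_∈_; _─_; find; lose)
open import Data.List.Membership.Propositional.Properties
  using (∈-++⁺ˡ; ∈-++⁺ʳ; ∈-++⁻; ∈-map⁺; ∈-map⁻; ∈-filter⁺; ∈-filter⁻; ∈-concatMap⁻; ∈-allFin)
open import Data.List.Properties using (length-++; length-map; length-removeAt′; length-tabulate)
open import Data.List.Relation.Unary.All as All using (All; []; _∷_)
import Data.List.Relation.Unary.All.Properties as Allₚ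
open import Data.List.Relation.Unary.AllPairs as AllPairs using (AllPairs; []; _∷_)
import Data.List.Relation.Unary.AllPairs.Properties as AllPairsₚ
open import Data.List.Relation.Unary.Any using (here; there; index)
open import Data.List.Relation.Unary.Unique.Propositional using (Unique)
import Data.List.Relation.Unary.Unique.Propositional.Properties as Uniqueₚ
open import Data.Nat using (ℕ; zero; suc; _+_; _*_; _^_; _∸_; _≤_; _<_; _≥_; z≤n; s≤s)
open import Data.Nat.Coprimality using (1-coprimeTo) renaming (sym to sym-coprime)
open import Data.Nat.Properties
  using ( +-suc; +-comm; +-identityʳ; +-cancelˡ-≡; +-mono-≤; +-monoʳ-≤; *-comm; *-monoˡ-≤; ^-monoʳ-≤; ^-distribˡ-+-*
        ; m^n>0; ∸-monoˡ-≤; m∸n+n≡m; m+[n∸m]≡n; m≤m+n; ≤-trans; ≤-reflexive; n≤1+n; m≤n+o⇒m∸n≤o; module ≤-Reasoning)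
open import Data.Nat.Tactic.RingSolver using (solve-∀)
open import Data.Product using (∃-syntax; _×_; _,_; proj₁; proj₂)
open import Data.Rational using (ℚ; 0ℚ; 1ℚ)
import Data.Rational as ℚ
import Data.Rational.Properties as ℚ
open import Data.Sum using (_⊎_; inj₁; inj₂)
open import Data.Vec using ([]; _∷_)
open import Data.Vec.Properties using (≡-dec; ∷-injectiveʳ; zipWith-assoc; zipWith-identityˡ; zipWith-identityʳ)
open import Function using (_∘_; Equivalence)
open import Relation.Binary.Definitions using (DecidableEquality)
open import Relation.Binary.PropositionalEquality
open import Relation.Nullary using (¬_; contradiction; Dec; does; yes; no; ¬?)
open import Relation.Nullary.Decidable using (_×-dec_; _⊎-dec_; decidable-stable; T?; dec-true; dec-false)
open import Relation.Unary using (Pred; Decidable)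
open import Defs using (sublists; _△_; allSubsets; SymmetricExchange; IsDeltaMatroid; isDeltaMatroid?; d)

open import Algebra.Properties.CommutativeSemigroup
  (CommutativeRing.+-commutativeSemigroup xor-∧-commutativeRing) using () renaming (interchange to xor-interchange)

module _ {A : Set} where

  ∈-─ : ∀ {x y} {ys : List A} (x∈ys : x ∈ ys) → y ∈ ys → x ≢ y → y ∈ ys ─ x∈ys
  ∈-─ (here refl) (here refl) x≢y = contradiction refl x≢y
  ∈-─ (here refl) (there y∈ys) _  = y∈ys
  ∈-─ (there x∈ys) (here refl) _  = here refl
  ∈-─ (there x∈ys) (there y∈ys) x≢y = there (∈-─ x∈ys y∈ys x≢y)

  Unique-⊆⇒length≤ : ∀ {xs ys : List A} → Unique xs → All (_∈ ys) xs → length xs ≤ length ys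
  Unique-⊆⇒length≤ [] [] = z≤n
  Unique-⊆⇒length≤ {x ∷ xs} {ys} (x∉xs ∷ xs!) (x∈ys ∷ xs⊆ys) = begin
    suc (length xs)          ≤⟨ s≤s (Unique-⊆⇒length≤ xs! xs⊆ys─x) ⟩
    suc (length (ys ─ x∈ys)) ≡⟨ sym (length-removeAt′ ys (index x∈ys)) ⟩
    length ys                ∎
    where
    open ≤-Reasoning
    xs⊆ys─x : All (_∈ ys ─ x∈ys) xs
    xs⊆ys─x = All.zipWith (λ (x≢y , y∈ys) → ∈-─ x∈ys y∈ys x≢y) (x∉xs , xs⊆ys)

  filterᵇ∈sublists : ∀ (χ : A → Bool) xs → filterᵇ χ xs ∈ sublists xs
  filterᵇ∈sublists χ [] = here refl
  filterᵇ∈sublists χ (x ∷ xs) with χ x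
  ... | true  = ∈-++⁺ʳ (sublists xs) (∈-map⁺ (x ∷_) (filterᵇ∈sublists χ xs))
  ... | false = ∈-++⁺ˡ (filterᵇ∈sublists χ xs)

  count : (A → Bool) → List A → ℕ
  count χ xs = length (filterᵇ χ xs)

  count-++ : ∀ χ xs ys → count χ (xs ++ ys) ≡ count χ xs + count χ ys
  count-++ χ [] ys = refl
  count-++ χ (x ∷ xs) ys with χ x
  ... | true  = cong suc (count-++ χ xs ys)
  ... | false = count-++ χ xs ys

  count-cong : ∀ {χ ψ} → (∀ x → χ x ≡ ψ x) → ∀ xs → count χ xs ≡ count ψ xs
  count-cong {χ} {ψ} χ≗ψ [] = refl
  count-cong {χ} {ψ} χ≗ψ (x ∷ xs) rewrite χ≗ψ x with ψ x
  ... | true  = cong suc (count-cong χ≗ψ xs)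
  ... | false = count-cong χ≗ψ xs

  count+count-not : ∀ χ xs → count χ xs + count (not ∘ χ) xs ≡ length xs
  count+count-not χ [] = refl
  count+count-not χ (x ∷ xs) with χ x
  ... | true  = cong suc (count+count-not χ xs)
  ... | false = trans (+-suc _ _) (cong suc (count+count-not χ xs))

  count≤count-∧-not+count : ∀ χ ψ xs → count χ xs ≤ count (λ x → χ x ∧ not (ψ x)) xs + count ψ xs
  count≤count-∧-not+count χ ψ [] = z≤n
  count≤count-∧-not+count χ ψ (x ∷ xs) with ih ← count≤count-∧-not+count χ ψ xs | χ x | ψ x
  ... | true  | true  = ≤-trans (s≤s ih) (≤-reflexive (sym (+-suc _ _)))
  ... | true  | false = s≤s ih
  ... | false | true  = ≤-trans ih (≤-trans (n≤1+n _) (≤-reflexive (sym (+-suc _ _))))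
  ... | false | false = ih

  AllPairs-++⁺ : ∀ {R : A → A → Set} {xs ys} → AllPairs R xs → AllPairs R ys →
                 (∀ {x y} → x ∈ xs → y ∈ ys → R x y) → AllPairs R (xs ++ ys)
  AllPairs-++⁺ Rxs Rys cross = AllPairsₚ.++⁺ Rxs Rys (All.tabulate λ x∈ → All.tabulate λ y∈ → cross x∈ y∈)

module _ {A B : Set} where

  count-map : ∀ (χ : B → Bool) (f : A → B) xs → count χ (map f xs) ≡ count (χ ∘ f) xs
  count-map χ f [] = refl
  count-map χ f (x ∷ xs) with χ (f x)
  ... | true  = cong suc (count-map χ f xs)
  ... | false = count-map χ f xs

  length-concatMap-≥ : ∀ (f : A → List B) xs c → (∀ {x} → x ∈ xs → c ≤ length (f x)) →
                       length xs * c ≤ length (concatMap f xs)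
  length-concatMap-≥ f [] c _ = z≤n
  length-concatMap-≥ f (x ∷ xs) c c≤ = begin
    c + length xs * c                  ≤⟨ +-mono-≤ (c≤ (here refl)) (length-concatMap-≥ f xs c (c≤ ∘ there)) ⟩
    length (f x) + length (concatMap f xs) ≡⟨ sym (length-++ (f x)) ⟩
    length (f x ++ concatMap f xs)     ∎
    where open ≤-Reasoning

  AllPairs-concatMap⁺ : ∀ {R : A → A → Set} {S : B → B → Set} (f : B → List A) {xs} → AllPairs S xs →
    (∀ {x} → x ∈ xs → AllPairs R (f x)) →
    (∀ {x y} → x ∈ xs → y ∈ xs → S x y → ∀ {u v} → u ∈ f x → v ∈ f y → R u v) →
    AllPairs R (concatMap f xs)
  AllPairs-concatMap⁺ f [] _ _ = []
  AllPairs-concatMap⁺ f {x ∷ xs} (Sx ∷ Sxs) inner cross = AllPairs-++⁺ (inner (here refl))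
    (AllPairs-concatMap⁺ f Sxs (inner ∘ there) (λ x∈ y∈ → cross (there x∈) (there y∈)))
    λ u∈ v∈ → let y , y∈xs , v∈fy = find (∈-concatMap⁻ f v∈) in
      cross (here refl) (there y∈xs) (All.lookup Sx y∈xs) u∈ v∈fy

T-does⇒ : ∀ {A : Set} (a? : Dec A) → T (does a?) → A
T-does⇒ (yes a) _ = a
T-does⇒ (no _)  ()

T-not-does⇒ : ∀ {A : Set} (a? : Dec A) → T (not (does a?)) → ¬ A
T-not-does⇒ (yes _) ()
T-not-does⇒ (no ¬a) _ = ¬a

-- The 2 ^ length R Boolean functions that are true outside R; properSelections R omits the
-- constant one.
module Selections {A : Set} (_≟ᴬ_ : DecidableEquality A) where

  update : A → Bool → (A → Bool) → A → Bool
  update x b s y = if does (y ≟ᴬ x) then b else s y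

  update-≡ : ∀ x b s → update x b s x ≡ b
  update-≡ x b s rewrite dec-true (x ≟ᴬ x) refl = refl

  update-≢ : ∀ {x y} b s → y ≢ x → update x b s y ≡ s y
  update-≢ {x} {y} b s y≢x rewrite dec-false (y ≟ᴬ x) y≢x = refl

  selections : List A → List (A → Bool)
  selections []      = (λ _ → true) ∷ []
  selections (x ∷ R) = map (update x false) (selections R) ++ map (update x true) (selections R)

  properSelections : List A → List (A → Bool)
  properSelections []      = []
  properSelections (x ∷ R) = map (update x false) (selections R) ++ map (update x true) (properSelections R)

  length-selections : ∀ R → length (selections R) ≡ 2 ^ length R
  length-selections []      = refl
  length-selections (x ∷ R) = begin
    length (map (update x false) S ++ map (update x true) S) ≡⟨ length-++ (map (update x false) S) ⟩
    length (map (update x false) S) + length (map (update x true) S) ≡⟨ cong₂ _+_ (length-map _ S) (length-map _ S) ⟩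
    length S + length S                                      ≡⟨ cong₂ _+_ (length-selections R) (trans (length-selections R) (sym (+-identityʳ _))) ⟩
    2 ^ length R + (2 ^ length R + 0)                        ∎
    where open ≡-Reasoning
          S = selections R

  length-properSelections : ∀ R → suc (length (properSelections R)) ≡ 2 ^ length R
  length-properSelections []      = refl
  length-properSelections (x ∷ R) = begin
    suc (length (map (update x false) S ++ map (update x true) P)) ≡⟨ cong suc (length-++ (map (update x false) S)) ⟩
    suc (length (map (update x false) S) + length (map (update x true) P)) ≡⟨ cong suc (cong₂ _+_ (length-map _ S) (length-map _ P)) ⟩
    suc (length S + length P)                                ≡⟨ sym (+-suc (length S) (length P)) ⟩
    length S + suc (length P)                                ≡⟨ cong₂ _+_ (length-selections R) (trans (length-properSelections R) (sym (+-identityʳ _))) ⟩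
    2 ^ length R + (2 ^ length R + 0)                        ∎
    where open ≡-Reasoning
          S = selections R
          P = properSelections R

  ApartOn : List A → (A → Bool) → (A → Bool) → Set
  ApartOn R s t = ∃[ W ] W ∈ R × s W ≢ t W

  ApartOn-update⁺ : ∀ {x ss ts} {R : List A} → All (x ≢_) R → AllPairs (ApartOn R) ss → AllPairs (ApartOn R) ts →
    AllPairs (ApartOn (x ∷ R)) (map (update x false) ss ++ map (update x true) ts)
  ApartOn-update⁺ {x} {R = R} x∉R ss! ts! = AllPairs-++⁺
    (AllPairsₚ.map⁺ (AllPairs.map (extend false) ss!)) (AllPairsₚ.map⁺ (AllPairs.map (extend true) ts!)) apart-at-x
    where
    extend : ∀ b {s t} → ApartOn R s t → ApartOn (x ∷ R) (update x b s) (update x b t)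
    extend b {s} {t} (W , W∈R , sW≢tW) = W , there W∈R , λ eq →
      sW≢tW (trans (sym (update-≢ b s W≢x)) (trans eq (update-≢ b t W≢x)))
      where W≢x = All.lookup x∉R W∈R ∘ sym
    apart-at-x : ∀ {u v ss ts} → u ∈ map (update x false) ss → v ∈ map (update x true) ts → ApartOn (x ∷ R) u v
    apart-at-x u∈ v∈ with ∈-map⁻ (update x false) u∈ | ∈-map⁻ (update x true) v∈
    ... | s , _ , refl | t , _ , refl = x , here refl , λ eq →
      contradiction (trans (sym (update-≡ x false s)) (trans eq (update-≡ x true t))) λ ()

  selections-apart : ∀ {R} → Unique R → AllPairs (ApartOn R) (selections R)
  selections-apart []          = [] ∷ []
  selections-apart (x∉R ∷ R!) = ApartOn-update⁺ x∉R (selections-apart R!) (selections-apart R!)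

  properSelections-apart : ∀ {R} → Unique R → AllPairs (ApartOn R) (properSelections R)
  properSelections-apart []          = []
  properSelections-apart (x∉R ∷ R!) = ApartOn-update⁺ x∉R (selections-apart R!) (properSelections-apart R!)

  properSelections-reject : ∀ {R s} → Unique R → s ∈ properSelections R → ∃[ W ] W ∈ R × s W ≡ false
  properSelections-reject {x ∷ R} (x∉R ∷ R!) s∈ with ∈-++⁻ (map (update x false) (selections R)) s∈
  ... | inj₁ s∈₀ with ∈-map⁻ (update x false) s∈₀
  ...   | t , _ , refl = x , here refl , update-≡ x false t
  properSelections-reject {x ∷ R} (x∉R ∷ R!) s∈ | inj₂ s∈₁ with ∈-map⁻ (update x true) s∈₁
  ...   | t , t∈ , refl = let W , W∈R , tW = properSelections-reject R! t∈ in
    W , there W∈R , trans (update-≢ true t (All.lookup x∉R W∈R ∘ sym)) tW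

-- Subsets of [n]

private variable n : ℕ

infix 4 _≟ₛ_
_≟ₛ_ : DecidableEquality (Subset n)
_≟ₛ_ = ≡-dec _≟ᵇ_

△-assoc : Associative _≡_ (_△_ {n})
△-assoc = zipWith-assoc xor-assoc

△-identityˡ : ∀ (X : Subset n) → ∅ △ X ≡ X
△-identityˡ = zipWith-identityˡ xor-identityˡ

△-identityʳ : ∀ (X : Subset n) → X △ ∅ ≡ X
△-identityʳ = zipWith-identityʳ xor-identityʳ

△-self : ∀ (X : Subset n) → X △ X ≡ ∅
△-self []      = refl
△-self (x ∷ X) = cong₂ _∷_ (xor-same x) (△-self X)

△-cancelˡ : ∀ (X Y : Subset n) → X △ (X △ Y) ≡ Y
△-cancelˡ X Y = begin
  X △ (X △ Y) ≡⟨ △-assoc X X Y ⟨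
  (X △ X) △ Y ≡⟨ cong (_△ Y) (△-self X) ⟩
  ∅ △ Y       ≡⟨ △-identityˡ Y ⟩
  Y           ∎
  where open ≡-Reasoning

△-cancelʳ : ∀ (X Y : Subset n) → (X △ Y) △ Y ≡ X
△-cancelʳ X Y = begin
  (X △ Y) △ Y ≡⟨ △-assoc X Y Y ⟩
  X △ (Y △ Y) ≡⟨ cong (X △_) (△-self Y) ⟩
  X △ ∅       ≡⟨ △-identityʳ X ⟩
  X           ∎
  where open ≡-Reasoning

△-injectiveʳ : ∀ (X : Subset n) {Y Y′} → X △ Y ≡ X △ Y′ → Y ≡ Y′
△-injectiveʳ X {Y} {Y′} eq = trans (sym (△-cancelˡ X Y)) (trans (cong (X △_) eq) (△-cancelˡ X Y′))

⁅⁆-injective : ∀ {e f : Fin n} → ⁅ e ⁆ ≡ ⁅ f ⁆ → e ≡ f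
⁅⁆-injective {e = e} {f} eq = x∈⁅y⁆⇒x≡y f (subst (e ∈ₛ_) eq (x∈⁅x⁆ e))

△⁅⁆-injective : ∀ (Z : Subset n) {e f} → Z △ ⁅ e ⁆ ≡ Z △ ⁅ f ⁆ → e ≡ f
△⁅⁆-injective Z = ⁅⁆-injective ∘ △-injectiveʳ Z

⁅⁆∪⁅⁆≡⁅⁆△⁅⁆ : ∀ (e f : Fin n) → e ≢ f → ⁅ e ⁆ ∪ ⁅ f ⁆ ≡ ⁅ e ⁆ △ ⁅ f ⁆
⁅⁆∪⁅⁆≡⁅⁆△⁅⁆ zero    zero    e≢f = contradiction refl e≢f
⁅⁆∪⁅⁆≡⁅⁆△⁅⁆ zero    (suc f) _   = cong (true ∷_) (trans (∪-identityˡ _) (sym (△-identityˡ _)))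
⁅⁆∪⁅⁆≡⁅⁆△⁅⁆ (suc e) zero    _   = cong (true ∷_) (trans (∪-identityʳ _) (sym (△-identityʳ _)))
⁅⁆∪⁅⁆≡⁅⁆△⁅⁆ (suc e) (suc f) e≢f = cong (false ∷_) (⁅⁆∪⁅⁆≡⁅⁆△⁅⁆ e f (e≢f ∘ cong suc))

△-pair≡△⁅⁆△⁅⁆ : ∀ (X : Subset n) {e f} → e ≢ f → X △ (⁅ e ⁆ ∪ ⁅ f ⁆) ≡ (X △ ⁅ e ⁆) △ ⁅ f ⁆
△-pair≡△⁅⁆△⁅⁆ X {e} {f} e≢f = trans (cong (X △_) (⁅⁆∪⁅⁆≡⁅⁆△⁅⁆ e f e≢f)) (sym (△-assoc X ⁅ e ⁆ ⁅ f ⁆))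

△-single : ∀ (X : Subset n) e → X △ (⁅ e ⁆ ∪ ⁅ e ⁆) ≡ X △ ⁅ e ⁆
△-single X e = cong (X △_) (∪-idem ⁅ e ⁆)

△⁅⁆-△-single : ∀ (Z : Subset n) e → (Z △ ⁅ e ⁆) △ (⁅ e ⁆ ∪ ⁅ e ⁆) ≡ Z
△⁅⁆-△-single Z e = trans (△-single (Z △ ⁅ e ⁆) e) (△-cancelʳ Z ⁅ e ⁆)

△⁅⁆-△-pair : ∀ (Z : Subset n) {e g} → e ≢ g → (Z △ ⁅ e ⁆) △ (⁅ e ⁆ ∪ ⁅ g ⁆) ≡ Z △ ⁅ g ⁆
△⁅⁆-△-pair Z {e} {g} e≢g = trans (△-pair≡△⁅⁆△⁅⁆ (Z △ ⁅ e ⁆) e≢g) (cong (_△ ⁅ g ⁆) (△-cancelʳ Z ⁅ e ⁆))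

open module SubsetSelections {n} = Selections (_≟ₛ_ {n})

parity : Subset n → Bool
parity []      = false
parity (x ∷ X) = x xor parity X

parity-△ : ∀ (X Y : Subset n) → parity (X △ Y) ≡ parity X xor parity Y
parity-△ []      []      = refl
parity-△ (x ∷ X) (y ∷ Y) =
  trans (cong ((x xor y) xor_) (parity-△ X Y)) (xor-interchange x y (parity X) (parity Y))

parity-∅ : ∀ n → parity (∅ {n}) ≡ false
parity-∅ zero    = refl
parity-∅ (suc n) = parity-∅ n

parity-⁅⁆ : ∀ (e : Fin n) → parity ⁅ e ⁆ ≡ true
parity-⁅⁆ {suc n} zero = cong not (parity-∅ n)
parity-⁅⁆ (suc e)      = parity-⁅⁆ e

parity-△⁅⁆ : ∀ (X : Subset n) e → parity (X △ ⁅ e ⁆) ≡ not (parity X)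
parity-△⁅⁆ X e = begin
  parity (X △ ⁅ e ⁆)        ≡⟨ parity-△ X ⁅ e ⁆ ⟩
  parity X xor parity ⁅ e ⁆ ≡⟨ cong (parity X xor_) (parity-⁅⁆ e) ⟩
  parity X xor true         ≡⟨ xor-comm (parity X) true ⟩
  not (parity X)            ∎
  where open ≡-Reasoning

parity-△-pair : ∀ (X : Subset n) {e f} → e ≢ f → parity (X △ (⁅ e ⁆ ∪ ⁅ f ⁆)) ≡ parity X
parity-△-pair X {e} {f} e≢f = begin
  parity (X △ (⁅ e ⁆ ∪ ⁅ f ⁆))   ≡⟨ cong parity (△-pair≡△⁅⁆△⁅⁆ X e≢f) ⟩
  parity ((X △ ⁅ e ⁆) △ ⁅ f ⁆)   ≡⟨ parity-△⁅⁆ (X △ ⁅ e ⁆) f ⟩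
  not (parity (X △ ⁅ e ⁆))       ≡⟨ cong not (parity-△⁅⁆ X e) ⟩
  not (not (parity X))           ≡⟨ not-involutive (parity X) ⟩
  parity X                       ∎
  where open ≡-Reasoning

parity-△-single : ∀ (X : Subset n) e → parity (X △ (⁅ e ⁆ ∪ ⁅ e ⁆)) ≡ not (parity X)
parity-△-single X e = trans (cong (parity ∘ (X △_)) (∪-idem ⁅ e ⁆)) (parity-△⁅⁆ X e)

parity-△⁅⁆-≢ : ∀ (Z : Subset n) e → parity (Z △ ⁅ e ⁆) ≢ parity Z
parity-△⁅⁆-≢ Z e eq = not-¬ refl (trans (sym eq) (parity-△⁅⁆ Z e))

Adjacent : Subset n → Subset n → Set
Adjacent Z X = ∃[ e ] X ≡ Z △ ⁅ e ⁆

adjacent? : ∀ (Z X : Subset n) → Dec (Adjacent Z X)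
adjacent? Z X = any? (λ e → X ≟ₛ Z △ ⁅ e ⁆)

∃∉⊎⊆ : ∀ {ℓ} (D : Subset n) {P : Pred (Fin n) ℓ} → Decidable P →
       (∃[ g ] g ∈ₛ D × ¬ P g) ⊎ (∀ {i} → i ∈ₛ D → P i)
∃∉⊎⊆ D P? with any? (λ g → (g ∈? D) ×-dec ¬? (P? g))
... | yes g∈D∖P = inj₁ g∈D∖P
... | no  D⊆P   = inj₂ λ {i} i∈D → decidable-stable (P? i) (λ ¬Pi → D⊆P (i , i∈D , ¬Pi))

≡-△-pair : ∀ {X Y : Subset n} {e f} → e ∈ₛ X △ Y → f ∈ₛ X △ Y →
           (∀ {i} → i ∈ₛ X △ Y → i ≡ e ⊎ i ≡ f) → Y ≡ X △ (⁅ e ⁆ ∪ ⁅ f ⁆)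
≡-△-pair {X = X} {Y} {e} {f} e∈D f∈D D⊆ef =
  trans (sym (△-cancelˡ X Y)) (cong (X △_) (⊆-antisym D⊆pair pair⊆D))
  where
  D⊆pair : ∀ {i} → i ∈ₛ X △ Y → i ∈ₛ ⁅ e ⁆ ∪ ⁅ f ⁆
  D⊆pair i∈D with D⊆ef i∈D
  ... | inj₁ refl = x∈p∪q⁺ (inj₁ (x∈⁅x⁆ e))
  ... | inj₂ refl = x∈p∪q⁺ (inj₂ (x∈⁅x⁆ f))
  pair⊆D : ∀ {i} → i ∈ₛ ⁅ e ⁆ ∪ ⁅ f ⁆ → i ∈ₛ X △ Y
  pair⊆D i∈pair with x∈p∪q⁻ ⁅ e ⁆ ⁅ f ⁆ i∈pair
  ... | inj₁ i∈e = subst (_∈ₛ X △ Y) (sym (x∈⁅y⁆⇒x≡y e i∈e)) e∈D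
  ... | inj₂ i∈f = subst (_∈ₛ X △ Y) (sym (x∈⁅y⁆⇒x≡y f i∈f)) f∈D

△-pair-injective : ∀ (X : Subset n) {e f g} → f ≢ e → f ≢ g → X △ (⁅ e ⁆ ∪ ⁅ f ⁆) ≢ X △ (⁅ e ⁆ ∪ ⁅ g ⁆)
△-pair-injective X {e} {f} {g} f≢e f≢g eq
  with x∈p∪q⁻ ⁅ e ⁆ ⁅ g ⁆ (subst (f ∈ₛ_) (△-injectiveʳ X eq) (x∈p∪q⁺ (inj₂ (x∈⁅x⁆ f))))
... | inj₁ f∈e = f≢e (x∈⁅y⁆⇒x≡y e f∈e)
... | inj₂ f∈g = f≢g (x∈⁅y⁆⇒x≡y g f∈g)

∈-allSubsets : ∀ (X : Subset n) → X ∈ allSubsets n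
∈-allSubsets []          = here refl
∈-allSubsets (false ∷ X) = ∈-++⁺ˡ (∈-map⁺ (false ∷_) (∈-allSubsets X))
∈-allSubsets (true ∷ X)  = ∈-++⁺ʳ _ (∈-map⁺ (true ∷_) (∈-allSubsets X))

length-allSubsets : ∀ n → length (allSubsets n) ≡ 2 ^ n
length-allSubsets zero    = refl
length-allSubsets (suc n) = begin
  length (map (false ∷_) A ++ map (true ∷_) A)        ≡⟨ length-++ (map (false ∷_) A) ⟩
  length (map (false ∷_) A) + length (map (true ∷_) A) ≡⟨ cong₂ _+_ (length-map _ A) (length-map _ A) ⟩
  length A + length A                                  ≡⟨ cong₂ _+_ (length-allSubsets n) (trans (length-allSubsets n) (sym (+-identityʳ _))) ⟩
  2 ^ n + (2 ^ n + 0)                                  ∎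
  where open ≡-Reasoning
        A = allSubsets n

allSubsets-unique : ∀ n → Unique (allSubsets n)
allSubsets-unique zero    = [] ∷ []
allSubsets-unique (suc n) = Uniqueₚ.++⁺ (Uniqueₚ.map⁺ ∷-injectiveʳ (allSubsets-unique n))
  (Uniqueₚ.map⁺ ∷-injectiveʳ (allSubsets-unique n)) heads-differ
  where
  heads-differ : ∀ {X} → ¬ (X ∈ map (false ∷_) (allSubsets n) × X ∈ map (true ∷_) (allSubsets n))
  heads-differ (X∈₀ , X∈₁) with ∈-map⁻ (false ∷_) X∈₀ | ∈-map⁻ (true ∷_) X∈₁
  ... | _ , _ , refl | _ , _ , ()

setsOfParity : ∀ n → Bool → List (Subset n)
setsOfParity n b = filterᵇ (λ X → does (parity X ≟ᵇ b)) (allSubsets n)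

∈-setsOfParity⁻ : ∀ {b} {X : Subset n} → X ∈ setsOfParity n b → parity X ≡ b
∈-setsOfParity⁻ {n} {b} {X} X∈ = T-does⇒ (parity X ≟ᵇ b) (proj₂ (∈-filter⁻ (T? ∘ _) {xs = allSubsets n} X∈))

setsOfParity-unique : ∀ n b → Unique (setsOfParity n b)
setsOfParity-unique n b = Uniqueₚ.filter⁺ _ (allSubsets-unique n)

does-not-≟ : ∀ x b → does (not x ≟ᵇ b) ≡ not (does (x ≟ᵇ b))
does-not-≟ false false = refl
does-not-≟ false true  = refl
does-not-≟ true  false = refl
does-not-≟ true  true  = refl

length-setsOfParity : ∀ m b → length (setsOfParity (suc m) b) ≡ 2 ^ m
length-setsOfParity m b = begin
  count χ (map (false ∷_) A ++ map (true ∷_) A)          ≡⟨ count-++ χ (map (false ∷_) A) _ ⟩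
  count χ (map (false ∷_) A) + count χ (map (true ∷_) A) ≡⟨ cong₂ _+_ (count-map χ _ A) (count-map χ _ A) ⟩
  count χ A + count (λ X → does (not (parity X) ≟ᵇ b)) A ≡⟨ cong (count χ A +_) (count-cong (λ X → does-not-≟ (parity X) b) A) ⟩
  count χ A + count (not ∘ χ) A                          ≡⟨ count+count-not χ A ⟩
  length A                                               ≡⟨ length-allSubsets m ⟩
  2 ^ m                                                  ∎
  where open ≡-Reasoning
        χ : ∀ {k} → Subset k → Bool
        χ X = does (parity X ≟ᵇ b)
        A = allSubsets m

count-otherParity : ∀ m b → count (λ X → not (does (parity X ≟ᵇ b))) (allSubsets (suc m)) ≡ 2 ^ m
count-otherParity m b = +-cancelˡ-≡ (2 ^ m) _ _ (begin
  2 ^ m + count (not ∘ χ) A         ≡⟨ cong (_+ count (not ∘ χ) A) (length-setsOfParity m b) ⟨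
  count χ A + count (not ∘ χ) A     ≡⟨ count+count-not χ A ⟩
  length A                          ≡⟨ length-allSubsets (suc m) ⟩
  2 ^ m + (2 ^ m + 0)               ≡⟨ cong (2 ^ m +_) (+-identityʳ _) ⟩
  2 ^ m + 2 ^ m                     ∎)
  where open ≡-Reasoning
        χ = λ (X : Subset (suc m)) → does (parity X ≟ᵇ b)
        A = allSubsets (suc m)

count-adjacent : ∀ (Z : Subset n) → count (does ∘ adjacent? Z) (allSubsets n) ≤ n
count-adjacent {n} Z = begin
  count (does ∘ adjacent? Z) (allSubsets n) ≤⟨ Unique-⊆⇒length≤ (Uniqueₚ.filter⁺ _ (allSubsets-unique n))
                                                                  (All.tabulate neighbour) ⟩
  length (map (λ e → Z △ ⁅ e ⁆) (allFin n)) ≡⟨ length-map _ (allFin n) ⟩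
  length (allFin n)                        ≡⟨ length-tabulate {n = n} (λ i → i) ⟩
  n                                        ∎
  where
  open ≤-Reasoning
  neighbour : ∀ {X} → X ∈ filterᵇ (does ∘ adjacent? Z) (allSubsets n) → X ∈ map (λ e → Z △ ⁅ e ⁆) (allFin n)
  neighbour {X} X∈ with T-does⇒ (adjacent? Z X) (proj₂ (∈-filter⁻ (T? ∘ _) {xs = allSubsets n} X∈))
  ... | e , refl = ∈-map⁺ _ (∈-allFin e)

far : Subset n → List (Subset n)
far {n} Z = filterᵇ (λ X → not (does (parity X ≟ᵇ parity Z)) ∧ not (does (adjacent? Z X))) (allSubsets n)

∈-far⁻ : ∀ {Z X : Subset n} → X ∈ far Z → parity X ≢ parity Z × ¬ Adjacent Z X
∈-far⁻ {n} {Z} {X} X∈ with Equivalence.to T-∧ (proj₂ (∈-filter⁻ (T? ∘ _) {xs = allSubsets n} X∈))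
... | otherParity , notAdjacent =
  T-not-does⇒ (parity X ≟ᵇ parity Z) otherParity , T-not-does⇒ (adjacent? Z X) notAdjacent

far-unique : ∀ (Z : Subset n) → Unique (far Z)
far-unique {n} Z = Uniqueₚ.filter⁺ _ (allSubsets-unique n)

length-far : ∀ {m} (Z : Subset (suc m)) → 2 ^ m ∸ suc m ≤ length (far Z)
length-far {m} Z = m≤n+o⇒m∸n≤o (2 ^ m) (suc m) (begin
  2 ^ m                                                ≡⟨ count-otherParity m (parity Z) ⟨
  count (not ∘ sameParity) A                           ≤⟨ count≤count-∧-not+count (not ∘ sameParity) (does ∘ adjacent? Z) A ⟩
  length (far Z) + count (does ∘ adjacent? Z) A        ≤⟨ +-monoʳ-≤ (length (far Z)) (count-adjacent Z) ⟩
  length (far Z) + suc m                               ≡⟨ +-comm (length (far Z)) (suc m) ⟩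
  suc m + length (far Z)                               ∎)
  where open ≤-Reasoning
        sameParity = λ (X : Subset (suc m)) → does (parity X ≟ᵇ parity Z)
        A = allSubsets (suc m)

-- Families of subsets given by characteristic functions

Fam : (Subset n → Bool) → List (Subset n)
Fam {n} χ = filterᵇ χ (allSubsets n)

∈-Fam⁺ : ∀ (χ : Subset n → Bool) {X} → χ X ≡ true → X ∈ Fam χ
∈-Fam⁺ χ {X} χX = ∈-filter⁺ (T? ∘ χ) (∈-allSubsets X) (Equivalence.from T-≡ χX)

∈-Fam⁻ : ∀ (χ : Subset n → Bool) {X} → X ∈ Fam χ → χ X ≡ true
∈-Fam⁻ {n} χ X∈ = Equivalence.to T-≡ (proj₂ (∈-filter⁻ (T? ∘ χ) {xs = allSubsets n} X∈))

Apart : (Subset n → Bool) → (Subset n → Bool) → Set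
Apart χ ψ = ∃[ X ] χ X ≢ ψ X

Apart⇒Fam≢ : ∀ {χ ψ : Subset n → Bool} → Apart χ ψ → Fam χ ≢ Fam ψ
Apart⇒Fam≢ {χ = χ} {ψ} (X , χX≢ψX) eq with χ X in χX | ψ X in ψX
... | true  | true  = χX≢ψX refl
... | false | false = χX≢ψX refl
... | true  | false = contradiction (trans (sym (∈-Fam⁻ ψ (subst (X ∈_) eq (∈-Fam⁺ χ χX)))) ψX) λ ()
... | false | true  = contradiction (trans (sym (∈-Fam⁻ χ (subst (X ∈_) (sym eq) (∈-Fam⁺ ψ ψX)))) χX) λ ()

ExchangeAt : (Subset n → Bool) → Subset n → Subset n → Fin n → Set
ExchangeAt χ X Y e = ∃[ f ] f ∈ₛ X △ Y × χ (X △ (⁅ e ⁆ ∪ ⁅ f ⁆)) ≡ true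

SymmetricExchangeᵇ : (Subset n → Bool) → Set
SymmetricExchangeᵇ χ = ∀ {X Y} → χ X ≡ true → χ Y ≡ true → ∀ {e} → e ∈ₛ X △ Y → ExchangeAt χ X Y e

Fam-isDeltaMatroid : ∀ (χ : Subset n → Bool) {X₀} → χ X₀ ≡ true → SymmetricExchangeᵇ χ → IsDeltaMatroid (Fam χ)
Fam-isDeltaMatroid χ {X₀} χX₀ exchange = nonEmpty , symmetricExchange
  where
  nonEmpty : Fam χ ≢ []
  nonEmpty eq with subst (X₀ ∈_) eq (∈-Fam⁺ χ χX₀)
  ... | ()
  symmetricExchange : SymmetricExchange (Fam χ)
  symmetricExchange = All.tabulate λ X∈ → All.tabulate λ Y∈ → All.tabulate λ _ e∈D →
    let f , f∈D , χW = exchange (∈-Fam⁻ χ X∈) (∈-Fam⁻ χ Y∈) e∈D in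
    lose (∈-allFin f) (f∈D , ∈-Fam⁺ χ χW)

exchange⊎∃-second : ∀ {χ : Subset n → Bool} {X Y e} → χ Y ≡ true → e ∈ₛ X △ Y →
                    ExchangeAt χ X Y e ⊎ (∃[ f ] f ∈ₛ X △ Y × f ≢ e)
exchange⊎∃-second {χ = χ} {X} {Y} {e} χY e∈D with ∃∉⊎⊆ (X △ Y) (_≟ e)
... | inj₁ second = inj₂ second
... | inj₂ D⊆e    = inj₁ (e , e∈D , subst (λ W → χ W ≡ true) (≡-△-pair e∈D e∈D (inj₁ ∘ D⊆e)) χY)

length≤d : ∀ (χs : List (Subset n → Bool)) → AllPairs Apart χs → All (IsDeltaMatroid ∘ Fam) χs → length χs ≤ d n
length≤d {n} χs apart isDeltaMatroid = begin
  length χs           ≡⟨ length-map Fam χs ⟨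
  length (map Fam χs) ≤⟨ Unique-⊆⇒length≤ (AllPairsₚ.map⁺ (AllPairs.map Apart⇒Fam≢ apart))
                                          (Allₚ.map⁺ (All.map counted isDeltaMatroid)) ⟩
  d n                 ∎
  where
  open ≤-Reasoning
  counted : ∀ {χ} → IsDeltaMatroid (Fam χ) → Fam χ ∈ filter isDeltaMatroid? (sublists (allSubsets n))
  counted {χ} = ∈-filter⁺ isDeltaMatroid? (filterᵇ∈sublists χ (allSubsets n))

-- Two constructions of delta-matroids

withAllEven : (Subset n → Bool) → Subset n → Bool
withAllEven s X = if parity X then s X else true

withAllEven-even : ∀ (s : Subset n → Bool) {X} → parity X ≡ false → withAllEven s X ≡ true
withAllEven-even s pX rewrite pX = refl

withAllEven-exchange : ∀ (s : Subset n → Bool) → SymmetricExchangeᵇ (withAllEven s)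
withAllEven-exchange s {X} _ χY {e} e∈D with parity X in pX | exchange⊎∃-second {χ = withAllEven s} χY e∈D
... | true  | _                    = e , e∈D , withAllEven-even s (trans (parity-△-single X e) (cong not pX))
... | false | inj₁ exchange        = exchange
... | false | inj₂ (f , f∈D , f≢e) = f , f∈D , withAllEven-even s (trans (parity-△-pair X (f≢e ∘ sym)) pX)

withAllEven-odd : ∀ (s : Subset n → Bool) {X} → parity X ≡ true → withAllEven s X ≡ s X
withAllEven-odd s pX rewrite pX = refl

withAllEven-apart : ∀ {s t : Subset n → Bool} → ApartOn (setsOfParity n true) s t → Apart (withAllEven s) (withAllEven t)
withAllEven-apart {s = s} {t} (W , W∈ , sW≢tW) = W , λ eq →
  sW≢tW (trans (sym (withAllEven-odd s pW)) (trans eq (withAllEven-odd t pW)))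
  where pW = ∈-setsOfParity⁻ W∈

withAllEven-isDeltaMatroid : ∀ (s : Subset n → Bool) → IsDeltaMatroid (Fam (withAllEven s))
withAllEven-isDeltaMatroid {n} s = Fam-isDeltaMatroid _ {∅} (withAllEven-even s (parity-∅ n)) (withAllEven-exchange s)

omitEdge : Subset n → Fin n → (Subset n → Bool) → Subset n → Bool
omitEdge Z a s X =
  if does (parity X ≟ᵇ parity Z) then not (does (X ≟ₛ Z))
  else if does (adjacent? Z X) then not (does (X ≟ₛ Z △ ⁅ a ⁆))
  else s X

module _ (Z : Subset n) (a : Fin n) (s : Subset n → Bool) where

  omitEdge-sameParity : ∀ {X} → parity X ≡ parity Z → X ≢ Z → omitEdge Z a s X ≡ true
  omitEdge-sameParity {X} pX X≢Z rewrite dec-true (parity X ≟ᵇ parity Z) pX | dec-false (X ≟ₛ Z) X≢Z = refl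

  omitEdge-centre : omitEdge Z a s Z ≡ false
  omitEdge-centre rewrite dec-true (parity Z ≟ᵇ parity Z) refl | dec-true (Z ≟ₛ Z) refl = refl

  omitEdge-neighbour : ∀ e → omitEdge Z a s (Z △ ⁅ e ⁆) ≡ not (does (Z △ ⁅ e ⁆ ≟ₛ Z △ ⁅ a ⁆))
  omitEdge-neighbour e
    rewrite dec-false (parity (Z △ ⁅ e ⁆) ≟ᵇ parity Z) (parity-△⁅⁆-≢ Z e)
          | dec-true (adjacent? Z (Z △ ⁅ e ⁆)) (e , refl) = refl

  omitEdge-omitted : omitEdge Z a s (Z △ ⁅ a ⁆) ≡ false
  omitEdge-omitted rewrite omitEdge-neighbour a | dec-true (Z △ ⁅ a ⁆ ≟ₛ Z △ ⁅ a ⁆) refl = refl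

  omitEdge-kept : ∀ {e} → e ≢ a → omitEdge Z a s (Z △ ⁅ e ⁆) ≡ true
  omitEdge-kept {e} e≢a
    rewrite omitEdge-neighbour e | dec-false (Z △ ⁅ e ⁆ ≟ₛ Z △ ⁅ a ⁆) (e≢a ∘ △⁅⁆-injective Z) = refl

  omitEdge-far : ∀ {X} → parity X ≢ parity Z → ¬ Adjacent Z X → omitEdge Z a s X ≡ s X
  omitEdge-far {X} pX ¬adj rewrite dec-false (parity X ≟ᵇ parity Z) pX | dec-false (adjacent? Z X) ¬adj = refl

  private
    ≢-omitted : ∀ {W} → omitEdge Z a s W ≡ true → W ≢ Z △ ⁅ a ⁆
    ≢-omitted χW refl = contradiction (trans (sym χW) omitEdge-omitted) λ ()

    ≢-centre : ∀ {W} → omitEdge Z a s W ≡ true → W ≢ Z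
    ≢-centre χW refl = contradiction (trans (sym χW) omitEdge-centre) λ ()

  exchange-sameParity : ∀ {X Y e} → parity X ≡ parity Z → omitEdge Z a s Y ≡ true → e ∈ₛ X △ Y →
                        ExchangeAt (omitEdge Z a s) X Y e
  exchange-sameParity {X} {Y} {e} pX χY e∈D with exchange⊎∃-second {χ = omitEdge Z a s} χY e∈D
  ... | inj₁ exchange = exchange
  ... | inj₂ (f , f∈D , f≢e) with X △ (⁅ e ⁆ ∪ ⁅ f ⁆) ≟ₛ Z
  ...   | no  W≢Z = f , f∈D , omitEdge-sameParity (trans (parity-△-pair X (f≢e ∘ sym)) pX) W≢Z
  ...   | yes W≡Z with ∃∉⊎⊆ (X △ Y) (λ g → (g ≟ e) ⊎-dec (g ≟ f))
  ...     | inj₁ (g , g∈D , g∉ef) =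
    g , g∈D , omitEdge-sameParity (trans (parity-△-pair X (g∉ef ∘ inj₁ ∘ sym)) pX)
                (λ W′≡Z → △-pair-injective X f≢e (g∉ef ∘ inj₂ ∘ sym) (trans W≡Z (sym W′≡Z)))
  ...     | inj₂ D⊆ef = ⊥-elim (≢-centre χY (trans (≡-△-pair e∈D f∈D D⊆ef) W≡Z))

  exchange-neighbour : ∀ {Y e} → omitEdge Z a s (Z △ ⁅ e ⁆) ≡ true → omitEdge Z a s Y ≡ true →
                       e ∈ₛ (Z △ ⁅ e ⁆) △ Y → ExchangeAt (omitEdge Z a s) (Z △ ⁅ e ⁆) Y e
  exchange-neighbour {Y} {e} χX χY e∈D with ∃∉⊎⊆ ((Z △ ⁅ e ⁆) △ Y) (λ g → (g ≟ e) ⊎-dec (g ≟ a))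
  ... | inj₁ (g , g∈D , g∉ea) =
    g , g∈D , subst (λ W → omitEdge Z a s W ≡ true) (sym (△⁅⁆-△-pair Z (g∉ea ∘ inj₁ ∘ sym)))
                    (omitEdge-kept (g∉ea ∘ inj₂))
  ... | inj₂ D⊆ea with a ∈? ((Z △ ⁅ e ⁆) △ Y)
  ...   | yes a∈D = ⊥-elim (≢-omitted χY (trans (≡-△-pair e∈D a∈D D⊆ea) (△⁅⁆-△-pair Z e≢a)))
    where e≢a : e ≢ a
          e≢a refl = ≢-omitted χX refl
  ...   | no  a∉D = ⊥-elim (≢-centre χY (trans (≡-△-pair e∈D e∈D D⊆e) (△⁅⁆-△-single Z e)))
    where D⊆e : ∀ {i} → i ∈ₛ (Z △ ⁅ e ⁆) △ Y → i ≡ e ⊎ i ≡ e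
          D⊆e i∈D with D⊆ea i∈D
          ... | inj₁ i≡e = inj₁ i≡e
          ... | inj₂ refl = contradiction i∈D a∉D

  exchange-otherParity : ∀ {X Y e} → parity X ≡ not (parity Z) → omitEdge Z a s X ≡ true → omitEdge Z a s Y ≡ true →
                         e ∈ₛ X △ Y → ExchangeAt (omitEdge Z a s) X Y e
  exchange-otherParity {X} {Y} {e} pX χX χY e∈D with X △ (⁅ e ⁆ ∪ ⁅ e ⁆) ≟ₛ Z
  ... | no W≢Z = e , e∈D , omitEdge-sameParity (trans (parity-△-single X e) (trans (cong not pX) (not-involutive _))) W≢Z
  ... | yes W≡Z with refl ← trans (sym (△-cancelʳ X ⁅ e ⁆)) (cong (_△ ⁅ e ⁆) (trans (sym (△-single X e)) W≡Z)) =
    exchange-neighbour χX χY e∈D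

  omitEdge-exchange : SymmetricExchangeᵇ (omitEdge Z a s)
  omitEdge-exchange {X} {Y} χX χY {e} e∈D = byParity (parity X ≟ᵇ parity Z)
    where
    byParity : Dec (parity X ≡ parity Z) → ExchangeAt (omitEdge Z a s) X Y e
    byParity (yes pX) = exchange-sameParity pX χY e∈D
    byParity (no  pX) = exchange-otherParity (¬-not pX) χX χY e∈D

omitEdge-isDeltaMatroid : ∀ {k} (Z : Subset (suc (suc k))) a s → IsDeltaMatroid (Fam (omitEdge Z a s))
omitEdge-isDeltaMatroid Z a s =
  Fam-isDeltaMatroid _ {Z △ ⁅ punchIn a zero ⁆} (omitEdge-kept Z a s (punchInᵢ≢i a zero)) (omitEdge-exchange Z a s)


module _ {Z : Subset n} {a : Fin n} {s : Subset n → Bool} where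

  omitEdge-apartᶻ : ∀ {Z′ a′ s′} → parity Z ≡ parity Z′ → Z ≢ Z′ → Apart (omitEdge Z a s) (omitEdge Z′ a′ s′)
  omitEdge-apartᶻ {Z′} {a′} {s′} pZ Z≢Z′ = Z , λ eq →
    contradiction (trans (sym (omitEdge-centre Z a s)) (trans eq (omitEdge-sameParity Z′ a′ s′ pZ Z≢Z′))) λ ()

  omitEdge-apartᵃ : ∀ {a′ s′} → a ≢ a′ → Apart (omitEdge Z a s) (omitEdge Z a′ s′)
  omitEdge-apartᵃ {a′} {s′} a≢a′ = Z △ ⁅ a ⁆ , λ eq →
    contradiction (trans (sym (omitEdge-omitted Z a s)) (trans eq (omitEdge-kept Z a′ s′ a≢a′))) λ ()

  omitEdge-apartˢ : ∀ {s′} → ApartOn (far Z) s s′ → Apart (omitEdge Z a s) (omitEdge Z a s′)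
  omitEdge-apartˢ {s′} (W , W∈far , sW≢s′W) = W , λ eq →
    sW≢s′W (trans (sym (omitEdge-far Z a s pW ¬adj)) (trans eq (omitEdge-far Z a s′ pW ¬adj)))
    where pW = proj₁ (∈-far⁻ W∈far)
          ¬adj = proj₂ (∈-far⁻ W∈far)

  omitEdge-apart-withAllEven : ∀ t → Apart (omitEdge Z a s) (withAllEven t)
  omitEdge-apart-withAllEven t = byParity (parity Z) refl
    where
    byParity : ∀ b → parity Z ≡ b → Apart (omitEdge Z a s) (withAllEven t)
    byParity false pZ = Z , λ eq →
      contradiction (trans (sym (omitEdge-centre Z a s)) (trans eq (withAllEven-even t pZ))) λ ()
    byParity true  pZ = Z △ ⁅ a ⁆ , λ eq →
      contradiction (trans (sym (omitEdge-omitted Z a s)) (trans eq (withAllEven-even t (trans (parity-△⁅⁆ Z a) (cong not pZ))))) λ ()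

  omitEdge-apart-proper : ∀ {Z′ a′ s′} → parity Z ≡ false → parity Z′ ≡ true → s′ ∈ properSelections (far Z′) →
                          Apart (omitEdge Z a s) (omitEdge Z′ a′ s′)
  omitEdge-apart-proper {Z′} {a′} {s′} pZ pZ′ s′∈ with Z ≟ₛ Z′ △ ⁅ a′ ⁆
  ... | no Z≢ = Z′ △ ⁅ a′ ⁆ , λ eq →
    contradiction (trans (sym (omitEdge-sameParity Z a s p (Z≢ ∘ sym))) (trans eq (omitEdge-omitted Z′ a′ s′))) λ ()
    where p : parity (Z′ △ ⁅ a′ ⁆) ≡ parity Z
          p = trans (parity-△⁅⁆ Z′ a′) (trans (cong not pZ′) (sym pZ))
  ... | yes refl = W , λ eq →
    contradiction (trans (sym (omitEdge-sameParity (Z′ △ ⁅ a′ ⁆) a s p W≢Z))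
                         (trans eq (trans (omitEdge-far Z′ a′ s′ pW ¬adj) s′W))) λ ()
    where
    rejected = properSelections-reject (far-unique Z′) s′∈
    W = proj₁ rejected
    W∈far = proj₁ (proj₂ rejected)
    s′W = proj₂ (proj₂ rejected)
    pW = proj₁ (∈-far⁻ W∈far)
    ¬adj = proj₂ (∈-far⁻ W∈far)
    p : parity W ≡ parity (Z′ △ ⁅ a′ ⁆)
    p = trans (¬-not (λ eq → pW (trans eq (sym pZ′)))) (sym pZ)
    W≢Z : W ≢ Z′ △ ⁅ a′ ⁆
    W≢Z W≡ = ¬adj (a′ , W≡)

-- Counting

module _ (sel : ∀ {n} → List (Subset n) → List (Subset n → Bool)) where

  centredAt : Subset n → List (Subset n → Bool)
  centredAt {n} Z = concatMap (λ a → map (omitEdge Z a) (sel (far Z))) (allFin n)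

  edgeFamilies : ∀ n → Bool → List (Subset n → Bool)
  edgeFamilies n b = concatMap centredAt (setsOfParity n b)

  CentredAt : Subset n → (Subset n → Bool) → Set
  CentredAt Z χ = ∃[ a ] ∃[ s ] s ∈ sel (far Z) × χ ≡ omitEdge Z a s

  EdgeFamily : Bool → (Subset n → Bool) → Set
  EdgeFamily b χ = ∃[ Z ] parity Z ≡ b × CentredAt Z χ

  ∈-centredAt⁻ : ∀ {Z : Subset n} {χ} → χ ∈ centredAt Z → CentredAt Z χ
  ∈-centredAt⁻ {n} {Z} χ∈ with find (∈-concatMap⁻ (λ a → map (omitEdge Z a) (sel (far Z))) {xs = allFin n} χ∈)
  ... | a , _ , χ∈ₐ with ∈-map⁻ (omitEdge Z a) χ∈ₐ
  ...   | s , s∈ , χ≡ = a , s , s∈ , χ≡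

  ∈-edgeFamilies⁻ : ∀ {b χ} → χ ∈ edgeFamilies n b → EdgeFamily b χ
  ∈-edgeFamilies⁻ {n} {b} χ∈ with find (∈-concatMap⁻ centredAt {xs = setsOfParity n b} χ∈)
  ... | Z , Z∈ , χ∈Z = Z , ∈-setsOfParity⁻ Z∈ , ∈-centredAt⁻ χ∈Z

  EdgeFamily-isDeltaMatroid : ∀ {k b} {χ : Subset (suc (suc k)) → Bool} → EdgeFamily b χ → IsDeltaMatroid (Fam χ)
  EdgeFamily-isDeltaMatroid (Z , _ , a , s , _ , refl) = omitEdge-isDeltaMatroid Z a s

  EdgeFamily-apart-withAllEven : ∀ {b} {χ : Subset n → Bool} → EdgeFamily b χ → ∀ t → Apart χ (withAllEven t)
  EdgeFamily-apart-withAllEven (Z , _ , a , s , _ , refl) = omitEdge-apart-withAllEven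

  module _ (sel-apart : ∀ {n} {R : List (Subset n)} → Unique R → AllPairs (ApartOn R) (sel R)) where

    centredAt-apart : ∀ (Z : Subset n) → AllPairs Apart (centredAt Z)
    centredAt-apart {n} Z = AllPairs-concatMap⁺ _ (Uniqueₚ.allFin⁺ n)
      (λ _ → AllPairsₚ.map⁺ (AllPairs.map omitEdge-apartˢ (sel-apart (far-unique Z))))
      λ _ _ a≢a′ χ∈ ψ∈ → apart a≢a′ (∈-map⁻ _ χ∈) (∈-map⁻ _ ψ∈)
      where
      apart : ∀ {a a′ χ ψ} → a ≢ a′ →
              ∃[ s ] _ × χ ≡ omitEdge Z a s → ∃[ s′ ] _ × ψ ≡ omitEdge Z a′ s′ → Apart χ ψ
      apart a≢a′ (_ , _ , refl) (_ , _ , refl) = omitEdge-apartᵃ a≢a′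

    edgeFamilies-apart : ∀ n b → AllPairs Apart (edgeFamilies n b)
    edgeFamilies-apart n b = AllPairs-concatMap⁺ centredAt (setsOfParity-unique n b) (λ {Z} _ → centredAt-apart Z)
      λ Z∈ Z′∈ Z≢Z′ χ∈ ψ∈ →
        apart (trans (∈-setsOfParity⁻ Z∈) (sym (∈-setsOfParity⁻ Z′∈))) Z≢Z′ (∈-centredAt⁻ χ∈) (∈-centredAt⁻ ψ∈)
      where
      apart : ∀ {Z Z′ : Subset n} {χ ψ} → parity Z ≡ parity Z′ → Z ≢ Z′ → CentredAt Z χ → CentredAt Z′ ψ → Apart χ ψ
      apart pZ Z≢Z′ (_ , _ , _ , refl) (_ , _ , _ , refl) = omitEdge-apartᶻ pZ Z≢Z′

  length-edgeFamilies : ∀ m b c → (∀ (Z : Subset (suc m)) → c ≤ length (sel (far Z))) →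
                        2 ^ m * (suc m * c) ≤ length (edgeFamilies (suc m) b)
  length-edgeFamilies m b c c≤ = begin
    2 ^ m * (suc m * c)                           ≡⟨ cong (_* (suc m * c)) (length-setsOfParity m b) ⟨
    length (setsOfParity (suc m) b) * (suc m * c) ≤⟨ length-concatMap-≥ centredAt (setsOfParity (suc m) b) _ (λ {Z} _ → perCentre Z) ⟩
    length (edgeFamilies (suc m) b)               ∎
    where
    open ≤-Reasoning
    perCentre : ∀ Z → suc m * c ≤ length (centredAt Z)
    perCentre Z = begin
      suc m * c                   ≡⟨ cong (_* c) (length-tabulate {n = suc m} (λ i → i)) ⟨
      length (allFin (suc m)) * c ≤⟨ length-concatMap-≥ (λ a → map (omitEdge Z a) (sel (far Z))) (allFin (suc m)) c
                                       (λ {a} _ → ≤-trans (c≤ Z) (≤-reflexive (sym (length-map (omitEdge Z a) (sel (far Z)))))) ⟩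
      length (centredAt Z)        ∎

allEven : ∀ n → List (Subset n → Bool)
allEven n = map withAllEven (selections (setsOfParity n true))

-- Odd-centred families draw on proper selections only: with the full selection,
-- omitEdge Z a (λ _ → true) and omitEdge (Z △ ⁅ a ⁆) a (λ _ → true) are the same family.
families : ∀ n → List (Subset n → Bool)
families n = edgeFamilies selections n false ++ edgeFamilies properSelections n true ++ allEven n

families-apart : ∀ n → AllPairs Apart (families n)
families-apart n = AllPairs-++⁺ (edgeFamilies-apart selections selections-apart n false)
  (AllPairs-++⁺ (edgeFamilies-apart properSelections properSelections-apart n true)
    (AllPairsₚ.map⁺ (AllPairs.map withAllEven-apart (selections-apart (setsOfParity-unique n true))))
    λ χ∈ ψ∈ → edge-vs-allEven properSelections (∈-edgeFamilies⁻ properSelections χ∈) ψ∈)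
  λ χ∈ ψ∈ → even-vs-rest (∈-edgeFamilies⁻ selections χ∈) (∈-++⁻ (edgeFamilies properSelections n true) ψ∈)
  where
  edge-vs-allEven : ∀ (sel : ∀ {n} → List (Subset n) → List (Subset n → Bool)) {b χ ψ} →
                    EdgeFamily sel b χ → ψ ∈ allEven n → Apart χ ψ
  edge-vs-allEven sel χ∈E ψ∈ with ∈-map⁻ withAllEven ψ∈
  ... | t , _ , refl = EdgeFamily-apart-withAllEven sel χ∈E t
  even-vs-rest : ∀ {χ ψ} → EdgeFamily selections false χ →
                 ψ ∈ edgeFamilies properSelections n true ⊎ ψ ∈ allEven n → Apart χ ψ
  even-vs-rest χ∈E (inj₂ ψ∈) = edge-vs-allEven selections χ∈E ψ∈
  even-vs-rest (Z , pZ , a , s , _ , refl) (inj₁ ψ∈) with ∈-edgeFamilies⁻ properSelections ψ∈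
  ... | Z′ , pZ′ , a′ , s′ , s′∈ , refl = omitEdge-apart-proper pZ pZ′ s′∈

families-isDeltaMatroid : ∀ k → All (IsDeltaMatroid ∘ Fam) (families (suc (suc k)))
families-isDeltaMatroid k = All.tabulate λ χ∈ → isDeltaMatroid (∈-++⁻ (edgeFamilies selections _ false) χ∈)
  where
  isDeltaMatroid : ∀ {χ} → χ ∈ edgeFamilies selections _ false ⊎ χ ∈ edgeFamilies properSelections _ true ++ allEven _ →
                   IsDeltaMatroid (Fam χ)
  isDeltaMatroid (inj₁ χ∈) = EdgeFamily-isDeltaMatroid selections (∈-edgeFamilies⁻ selections χ∈)
  isDeltaMatroid (inj₂ χ∈) with ∈-++⁻ (edgeFamilies properSelections _ true) χ∈
  ... | inj₁ χ∈₁ = EdgeFamily-isDeltaMatroid properSelections (∈-edgeFamilies⁻ properSelections χ∈₁)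
  ... | inj₂ χ∈₂ with ∈-map⁻ withAllEven χ∈₂
  ...   | s , _ , refl = withAllEven-isDeltaMatroid s

n<2^n : ∀ n → n < 2 ^ n
n<2^n zero    = s≤s z≤n
n<2^n (suc n) = +-mono-≤ (m^n>0 2 n) (≤-trans (n<2^n n) (m≤m+n (2 ^ n) 0))

n+n≤2^n : ∀ n → n + n ≤ 2 ^ n
n+n≤2^n zero    = z≤n
n+n≤2^n (suc n) = +-mono-≤ (n<2^n n) (≤-trans (n<2^n n) (m≤m+n (2 ^ n) 0))

[1+n]*2^n≤2^2^n : ∀ n → suc n * 2 ^ n ≤ 2 ^ (2 ^ n)
[1+n]*2^n≤2^2^n n = begin
  suc n * 2 ^ n   ≤⟨ *-monoˡ-≤ (2 ^ n) (n<2^n n) ⟩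
  2 ^ n * 2 ^ n   ≡⟨ ^-distribˡ-+-* 2 n n ⟨
  2 ^ (n + n)     ≤⟨ ^-monoʳ-≤ 2 (n+n≤2^n n) ⟩
  2 ^ (2 ^ n)     ∎
  where open ≤-Reasoning

-- For n = m + 1, N = 2 ^ m and P = 2 ^ N = (K′ + 1) · 2 ^ n, the three summands on the right are
-- lower bounds for the three blocks of `families n`; N · n ≤ P pays for the proper selections.
blocks-≥ : ∀ N n K′ P → P ≡ suc K′ * (2 * N) → N * n ≤ P → n * P ≤ N * (n * suc K′) + (N * (n * K′) + P)
blocks-≥ N n K′ P refl Nn≤P = begin
  n * (suc K′ * (2 * N))                    ≡⟨ expand N n K′ ⟩
  N * (n * suc K′) + (N * (n * K′) + N * n) ≤⟨ +-monoʳ-≤ (N * (n * suc K′)) (+-monoʳ-≤ (N * (n * K′)) Nn≤P) ⟩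
  N * (n * suc K′) + (N * (n * K′) + P)     ∎
  where
  open ≤-Reasoning
  expand : ∀ N n K′ → n * (suc K′ * (2 * N)) ≡ N * (n * suc K′) + (N * (n * K′) + N * n)
  expand = solve-∀

length-selections-far : ∀ {m} (Z : Subset (suc m)) → 2 ^ (2 ^ m ∸ suc m) ≤ length (selections (far Z))
length-selections-far Z = ≤-trans (^-monoʳ-≤ 2 (length-far Z)) (≤-reflexive (sym (length-selections (far Z))))

length-properSelections-far : ∀ {m} (Z : Subset (suc m)) → 2 ^ (2 ^ m ∸ suc m) ∸ 1 ≤ length (properSelections (far Z))
length-properSelections-far Z = ≤-trans (∸-monoˡ-≤ 1 (^-monoʳ-≤ 2 (length-far Z)))
  (≤-reflexive (cong (_∸ 1) (sym (length-properSelections (far Z)))))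

length-allEven : ∀ m → length (allEven (suc m)) ≡ 2 ^ (2 ^ m)
length-allEven m = begin
  length (allEven (suc m))                     ≡⟨ length-map withAllEven (selections (setsOfParity (suc m) true)) ⟩
  length (selections (setsOfParity (suc m) true)) ≡⟨ length-selections (setsOfParity (suc m) true) ⟩
  2 ^ length (setsOfParity (suc m) true)       ≡⟨ cong (2 ^_) (length-setsOfParity m true) ⟩
  2 ^ (2 ^ m)                                  ∎
  where open ≡-Reasoning

length-families : ∀ m → suc m * 2 ^ (2 ^ m) ≤ length (families (suc m))
length-families m = begin
  suc m * 2 ^ N                                             ≤⟨ blocks-≥ N (suc m) (K ∸ 1) (2 ^ N) 2^N≡ N*[1+m]≤2^N ⟩
  N * (suc m * suc (K ∸ 1)) + (N * (suc m * (K ∸ 1)) + 2 ^ N) ≡⟨ cong (λ k → N * (suc m * k) + (N * (suc m * (K ∸ 1)) + 2 ^ N)) K≡ ⟩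
  N * (suc m * K) + (N * (suc m * (K ∸ 1)) + 2 ^ N)         ≤⟨ +-mono-≤ (length-edgeFamilies selections m false K length-selections-far)
                                                                (+-mono-≤ (length-edgeFamilies properSelections m true (K ∸ 1) length-properSelections-far)
                                                                          (≤-reflexive (sym (length-allEven m)))) ⟩
  length E₀ + (length E₁ + length (allEven (suc m)))        ≡⟨ cong (length E₀ +_) (length-++ E₁) ⟨
  length E₀ + length (E₁ ++ allEven (suc m))                ≡⟨ length-++ E₀ ⟨
  length (families (suc m))                                 ∎
  where
  open ≤-Reasoning
  N = 2 ^ m
  K = 2 ^ (N ∸ suc m)
  E₀ = edgeFamilies selections (suc m) false
  E₁ = edgeFamilies properSelections (suc m) true
  K≡ : suc (K ∸ 1) ≡ K
  K≡ = m+[n∸m]≡n (m^n>0 2 (N ∸ suc m))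
  N*[1+m]≤2^N : N * suc m ≤ 2 ^ N
  N*[1+m]≤2^N = ≤-trans (≤-reflexive (*-comm N (suc m))) ([1+n]*2^n≤2^2^n m)
  2^N≡ : 2 ^ N ≡ suc (K ∸ 1) * (2 * N)
  2^N≡ = begin-equality
    2 ^ N                     ≡⟨ cong (2 ^_) (m∸n+n≡m (n<2^n m)) ⟨
    2 ^ (N ∸ suc m + suc m)   ≡⟨ ^-distribˡ-+-* 2 (N ∸ suc m) (suc m) ⟩
    K * (2 * N)               ≡⟨ cong (_* (2 * N)) K≡ ⟨
    suc (K ∸ 1) * (2 * N)     ∎

d-lower-bound : ∀ k → suc (suc k) * 2 ^ (2 ^ suc k) ≤ d (suc (suc k))
d-lower-bound k = ≤-trans (length-families (suc k))
  (length≤d (families (suc (suc k))) (families-apart _) (families-isDeltaMatroid k))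

ℕ→ℚ-mono-≤ : ∀ {a b} → a ≤ b → ℤ.+ a ℚ./ 1 ℚ.≤ ℤ.+ b ℚ./ 1
ℕ→ℚ-mono-≤ {a} {b} a≤b rewrite ℚ.normalize-coprime {a} {0} (sym-coprime (1-coprimeTo a))
                              | ℚ.normalize-coprime {b} {0} (sym-coprime (1-coprimeTo b)) =
  ℚ.*≤* (subst₂ ℤ._≤_ (sym (ℤ.*-identityʳ (ℤ.+ a))) (sym (ℤ.*-identityʳ (ℤ.+ b))) (ℤ.+≤+ a≤b))

shrink-≤ : ∀ {ε} → 0ℚ ℚ.≤ ε → ∀ {a b} → a ≤ b → (1ℚ ℚ.- ε) ℚ.* (ℤ.+ a ℚ./ 1) ℚ.≤ ℤ.+ b ℚ./ 1
shrink-≤ {ε} 0≤ε {a} {b} a≤b = begin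
  (1ℚ ℚ.- ε) ℚ.* (ℤ.+ a ℚ./ 1) ≤⟨ ℚ.*-monoʳ-≤-nonNeg (ℤ.+ a ℚ./ 1) {{ℚ.normalize-nonNeg a 1}} 1-ε≤1 ⟩
  1ℚ ℚ.* (ℤ.+ a ℚ./ 1)         ≡⟨ ℚ.*-identityˡ _ ⟩
  ℤ.+ a ℚ./ 1                  ≤⟨ ℕ→ℚ-mono-≤ a≤b ⟩
  ℤ.+ b ℚ./ 1                  ∎
  where
  open ℚ.≤-Reasoning
  1-ε≤1 : 1ℚ ℚ.- ε ℚ.≤ 1ℚ
  1-ε≤1 = ℚ.≤-trans (ℚ.+-monoʳ-≤ 1ℚ (ℚ.neg-antimono-≤ 0≤ε)) (ℚ.≤-reflexive (ℚ.+-identityʳ 1ℚ))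

theorem2 : ∀ (ε : ℚ) → 0ℚ ℚ.< ε → ∃[ n₀ ] ∀ (n : ℕ) → n ≥ n₀ →
    (1ℚ ℚ.- ε) ℚ.* ((ℤ.+ (n * 2 ^ (2 ^ (n ∸ 1)))) ℚ./ 1) ℚ.≤ (ℤ.+ d n) ℚ./ 1
theorem2 ε 0<ε = 2 , λ where
  (suc (suc k)) (s≤s (s≤s _)) → shrink-≤ (ℚ.<⇒≤ 0<ε) (d-lower-bound k)
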